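{- For an integer $m\ge 3$, let $G_{4m+2}$ be the graph with vertex set $\{x,y,z\}\cup\{y_1,\dots,y_{2m-1}\}\cup\{z_1,\dots,z_{2m}\}$ and edge set $\{yz\}\cup\{xy_i,\ y_iy : 1\le i\le 2m-1\}\cup\{xz_i,\ z_iz: 1\le i\le 2m\}\cup\{y_iy_{1+((i+m-2)\bmod (2m-1))}: 1\le i\le 2m-1\}\cup\{z_iz_j: 1\le i<j\le 2m,\ j\ne i+m\}\cup\{y_iz_j: 1\le i\le 2m-1,\ 1\le j\le 2m,\ j\ne i,\ j\ne i+1\}$. Then $G_{4m+2}$ is a $3$-$\gamma_t$-critical graph.
   Context: A set $S\subseteq V(G)$ is a total dominating set of a graph $G$ if every vertex of $G$ is adjacent to some vertex of $S$; $\gamma_t(G)$ is the minimum cardinality of a total dominating set. A graph $G$ is $k$-$\gamma_t$-critical if $\gamma_t(G)=k$ and for every vertex $v$ of $G$ that is not adjacent to a vertex of degree one, $\gamma_t(G-v)=k-1$. (The paper notes $G_{4m+2}$ has maximum degree $4m-1$ and order $4m+2=\Delta(G_{4m+2})+3$.) -}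

module Defs where

open import Data.Nat using (ℕ; zero; suc; _+_; _*_; _∸_; _≤_; _<_; _<ᵇ_)
open import Data.Bool using (true; false)
open import Data.Nat.DivMod using (_%_)
open import Data.Fin using (Fin; toℕ; punchIn)
open import Data.Fin.Subset using (Subset; _∈_; ∣_∣)
open import Data.Product using (∃; _×_)
open import Data.Sum using (_⊎_)
open import Relation.Nullary using (¬_)
open import Relation.Binary.PropositionalEquality using (_≡_)

Graph : ℕ → Set₁
Graph n = Fin n → Fin n → Set

IsTDS : ∀ {n} → Graph n → Subset n → Set
IsTDS {n} G S = (v : Fin n) → ∃ λ u → u ∈ S × G v u

TotalDomNumber : ∀ {n} → Graph n → ℕ → Set
TotalDomNumber {n} G k =
  (∃ λ (S : Subset n) → IsTDS G S × ∣ S ∣ ≡ k) ×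
  ((S : Subset n) → IsTDS G S → k ≤ ∣ S ∣)

deleteVertex : ∀ {n} → Graph (suc n) → Fin (suc n) → Graph n
deleteVertex G v a b = G (punchIn v a) (punchIn v b)

DegreeOne : ∀ {n} → Graph n → Fin n → Set
DegreeOne {n} G u = ∃ λ w → G u w × ((w' : Fin n) → G u w' → w' ≡ w)

IsTotalDomCritical : ∀ {n} → ℕ → Graph (suc n) → Set
IsTotalDomCritical {n} k G =
  TotalDomNumber G k ×
  ((v : Fin (suc n)) → ¬ (∃ λ u → G v u × DegreeOne G u) →
     TotalDomNumber (deleteVertex G v) (k ∸ 1))

-- Named vertices; Yi i, Zi j use the paper's 1-based indices.
data Vtx : Set where
  X Y Z : Vtx
  Yi Zi : ℕ → Vtx

-- Vertex layout on Fin (4m+2):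
--   0 ↦ x, 1 ↦ y, 2 ↦ z, 2+i ↦ y_i (1 ≤ i ≤ 2m-1), 2m+1+j ↦ z_j (1 ≤ j ≤ 2m).
decodeℕ : ℕ → ℕ → Vtx
decodeℕ m 0 = X
decodeℕ m 1 = Y
decodeℕ m 2 = Z
decodeℕ m (suc (suc (suc k))) with k <ᵇ 2 * m ∸ 1
... | true  = Yi (suc k)
... | false = Zi (suc k ∸ (2 * m ∸ 1))

decode : (m : ℕ) → Fin (2 + 4 * m) → Vtx
decode m v = decodeℕ m (toℕ v)

-- The (unordered) edges of G_{4m+2}, listed as in the paper.
-- The modulus 2m-1 is written suc (2 * m ∸ 2), equal to 2m-1 for m ≥ 1.
data Edge (m : ℕ) : Vtx → Vtx → Set where
  e-yz   : Edge m Y Z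
  e-xyi  : ∀ {i} → 1 ≤ i → i ≤ 2 * m ∸ 1 → Edge m X (Yi i)
  e-yiy  : ∀ {i} → 1 ≤ i → i ≤ 2 * m ∸ 1 → Edge m (Yi i) Y
  e-xzi  : ∀ {i} → 1 ≤ i → i ≤ 2 * m → Edge m X (Zi i)
  e-ziz  : ∀ {i} → 1 ≤ i → i ≤ 2 * m → Edge m (Zi i) Z
  e-yiyi : ∀ {i} → 1 ≤ i → i ≤ 2 * m ∸ 1 →
           Edge m (Yi i) (Yi (1 + ((i + m ∸ 2) % suc (2 * m ∸ 2))))
  e-zizj : ∀ {i j} → 1 ≤ i → i < j → j ≤ 2 * m → ¬ (j ≡ i + m) →
           Edge m (Zi i) (Zi j)
  e-yizj : ∀ {i j} → 1 ≤ i → i ≤ 2 * m ∸ 1 → 1 ≤ j → j ≤ 2 * m →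
           ¬ (j ≡ i) → ¬ (j ≡ i + 1) → Edge m (Yi i) (Zi j)

G4m2 : (m : ℕ) → Graph (2 + 4 * m)
G4m2 m a b = Edge m (decode m a) (decode m b) ⊎ Edge m (decode m b) (decode m a)

-- The y_i form a cycle in which y_a ~ y_b exactly when |a − b| ∈ {m − 1, m}.
-- {x, y, y₁} is a total dominating set.  Any total dominating set contains a
-- neighbour A ∈ {z, y_i} of y and a neighbour B ∈ {y, z_j} of z, so A ≠ B, and
-- some vertex is adjacent to neither: x, z_i or y_{max(1, j−1)} in the easy
-- cases.  For A = y_i, B = z_j, if z_i, z_{i+1}, y_{j−1} and y_j were all
-- dominated, y_i would be cycle-adjacent to the consecutive y_{j−1}, y_j, forcing
-- j = i + m or i + 1 = j + m, which z_i resp. z_{i+1} rules out (at the ends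
-- j = 1 and j = 2m, z_{1+m} resp. z_m takes over).  Hence γₜ = 3.
-- For criticality, every vertex v has two other vertices dominating G − v,
-- e.g. {y, z} for x, {y_{i+m−2}, z_i} for y_i with i ≤ m and {y_j, z_{j+m}} for
-- z_j with j ≤ m; as G has no loops, a total dominating set of G − v has at
-- least two vertices.

module Submission where

open import Defs
open import Data.Bool using (true; false; T)
open import Data.Fin using (Fin; toℕ; fromℕ<; punchIn; punchOut) renaming (zero to fzero; suc to fsuc)
open import Data.Fin.Properties
  using (toℕ<n; toℕ-fromℕ<; toℕ-injective; punchIn-punchOut; punchOut-injective; punchInᵢ≢i; ¬∀⟶∃¬)
  renaming (_≟_ to _≟ᶠ_)
open import Data.Fin.Subset using (Subset; _∈_; ∣_∣; ⁅_⁆; _∪_; _-_; inside; outside; ⊥)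
open import Data.Fin.Subset.Properties
  using (x∈p⇒∣p-x∣<∣p∣; x∈p∧x∉q⇒x∈p─q; x∈⁅y⁆⇒x≡y; x∈⁅x⁆; x∈p∪q⁺; ∣⁅x⁆∣≡1; ∣⊥∣≡0; ∪-identityˡ; ∪-identityʳ)
open import Data.Nat using (ℕ; zero; suc; _+_; _*_; _∸_; _≤_; _<_; _<ᵇ_; z≤n; s≤s; s≤s⁻¹; _≟_; _<?_; _≤?_)
open import Data.Nat.DivMod using (_%_; m<n⇒m%n≡m; [m+n]%n≡m%n)
open import Data.Nat.Properties
open import Data.Nat.Tactic.RingSolver using (solve-∀)
open import Data.Product using (∃; _×_; _,_; proj₁; proj₂)
open import Data.Sum using (_⊎_; inj₁; inj₂; swap)
open import Data.Unit using (tt)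
open import Data.Vec using (_∷_; here; there)
open import Function using (_∘_)
open import Relation.Binary.Definitions using (Irreflexive; tri<; tri≈; tri>)
open import Relation.Binary.PropositionalEquality
open import Relation.Nullary using (¬_; yes; no; contradiction)
open import Relation.Nullary.Decidable using (_⊎-dec_)
open import Relation.Unary using (Decidable)

private variable
  n : ℕ
  p : Subset n
  x y z : Fin n
  S : Subset n

x∈p⇒1≤∣p∣ : x ∈ p → 1 ≤ ∣ p ∣
x∈p⇒1≤∣p∣ x∈p = ≤-trans (s≤s z≤n) (x∈p⇒∣p-x∣<∣p∣ x∈p)

x∈p∧x≢y⇒x∈p-y : x ∈ p → x ≢ y → x ∈ p - y
x∈p∧x≢y⇒x∈p-y {y = y} x∈p x≢y = x∈p∧x∉q⇒x∈p─q x∈p (λ x∈⁅y⁆ → x≢y (x∈⁅y⁆⇒x≡y y x∈⁅y⁆))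

distinct⇒2≤∣p∣ : x ∈ p → y ∈ p → x ≢ y → 2 ≤ ∣ p ∣
distinct⇒2≤∣p∣ x∈p y∈p x≢y =
  ≤-trans (s≤s (x∈p⇒1≤∣p∣ (x∈p∧x≢y⇒x∈p-y y∈p (x≢y ∘ sym)))) (x∈p⇒∣p-x∣<∣p∣ x∈p)

distinct⇒3≤∣p∣ : x ∈ p → y ∈ p → z ∈ p → x ≢ y → x ≢ z → y ≢ z → 3 ≤ ∣ p ∣
distinct⇒3≤∣p∣ x∈p y∈p z∈p x≢y x≢z y≢z =
  ≤-trans (s≤s (distinct⇒2≤∣p∣ (x∈p∧x≢y⇒x∈p-y y∈p (x≢y ∘ sym)) (x∈p∧x≢y⇒x∈p-y z∈p (x≢z ∘ sym)) y≢z))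
          (x∈p⇒∣p-x∣<∣p∣ x∈p)

∣⁅x⁆∪⁅y⁆∣≡2 : x ≢ y → ∣ ⁅ x ⁆ ∪ ⁅ y ⁆ ∣ ≡ 2
∣⁅x⁆∪⁅y⁆∣≡2 {x = fzero}   {y = fzero}   x≢y = contradiction refl x≢y
∣⁅x⁆∪⁅y⁆∣≡2 {x = fzero}   {y = fsuc y}  _   = cong suc (trans (cong ∣_∣ (∪-identityˡ ⁅ y ⁆)) (∣⁅x⁆∣≡1 y))
∣⁅x⁆∪⁅y⁆∣≡2 {x = fsuc x}  {y = fzero}   _   = cong suc (trans (cong ∣_∣ (∪-identityʳ ⁅ x ⁆)) (∣⁅x⁆∣≡1 x))
∣⁅x⁆∪⁅y⁆∣≡2 {x = fsuc x}  {y = fsuc y}  x≢y = ∣⁅x⁆∪⁅y⁆∣≡2 (x≢y ∘ cong fsuc)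

PairDominates : Graph n → Fin n → Fin n → Set
PairDominates {n} G a b = (w : Fin n) → G w a ⊎ G w b

module _ {n : ℕ} {G : Graph n} where

  2≤∣tds∣ : Irreflexive _≡_ G → Fin n → IsTDS G S → 2 ≤ ∣ S ∣
  2≤∣tds∣ irr v tds with tds v
  ... | a , a∈S , _ with tds a
  ...   | b , b∈S , ab = distinct⇒2≤∣p∣ a∈S b∈S (λ a≡b → irr a≡b ab)

  tds-member-outside-pair : IsTDS G S → {a b : Fin n} → ¬ PairDominates G a b →
                            ∃ λ d → d ∈ S × d ≢ a × d ≢ b
  tds-member-outside-pair tds {a} {b} ¬dominates
    with ¬∀⟶∃¬ n _ dominatedByPair? (¬dominates ∘ dominates)
    where
    dominator : Fin n → Fin n
    dominator w = proj₁ (tds w)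
    dominatedByPair? : Decidable (λ w → dominator w ≡ a ⊎ dominator w ≡ b)
    dominatedByPair? w = (dominator w ≟ᶠ a) ⊎-dec (dominator w ≟ᶠ b)
    dominates : (∀ w → dominator w ≡ a ⊎ dominator w ≡ b) → PairDominates G a b
    dominates byPair w with tds w | byPair w
    ... | _ , _ , wd | inj₁ refl = inj₁ wd
    ... | _ , _ , wd | inj₂ refl = inj₂ wd
  ... | w , ¬byPair = proj₁ (tds w) , proj₁ (proj₂ (tds w)) , ¬byPair ∘ inj₁ , ¬byPair ∘ inj₂

  3≤∣tds∣ : (u v : Fin n) →
            (∀ {a b} → G u a → G v b → a ≢ b × ¬ PairDominates G a b) →
            IsTDS G S → 3 ≤ ∣ S ∣
  3≤∣tds∣ u v separated tds with tds u | tds v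
  ... | a , a∈S , ua | b , b∈S , vb with separated ua vb
  ...   | a≢b , ¬dominates with tds-member-outside-pair tds ¬dominates
  ...     | d , d∈S , d≢a , d≢b = distinct⇒3≤∣p∣ a∈S b∈S d∈S a≢b (d≢a ∘ sym) (d≢b ∘ sym)

module _ {n : ℕ} {G : Graph (suc n)} where

  pairDominates⇒γₜ≡2 : Irreflexive _≡_ G → {a b : Fin (suc n)} → a ≢ b → PairDominates G a b →
                        TotalDomNumber G 2
  pairDominates⇒γₜ≡2 irr {a} {b} a≢b dominates =
    (⁅ a ⁆ ∪ ⁅ b ⁆ , tds , ∣⁅x⁆∪⁅y⁆∣≡2 a≢b) , λ S → 2≤∣tds∣ irr fzero
    where
    tds : IsTDS G (⁅ a ⁆ ∪ ⁅ b ⁆)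
    tds w with dominates w
    ... | inj₁ wa = a , x∈p∪q⁺ (inj₁ (x∈⁅x⁆ a)) , wa
    ... | inj₂ wb = b , x∈p∪q⁺ (inj₂ (x∈⁅x⁆ b)) , wb

module _ {n : ℕ} {G : Graph (suc (suc n))} {v : Fin (suc (suc n))} where

  deleteVertex-γₜ≡2 : Irreflexive _≡_ G → {a b : Fin (suc (suc n))} →
                      v ≢ a → v ≢ b → a ≢ b →
                      (∀ w → w ≢ v → G w a ⊎ G w b) →
                      TotalDomNumber (deleteVertex G v) 2
  deleteVertex-γₜ≡2 irr v≢a v≢b a≢b dominates =
    pairDominates⇒γₜ≡2 (λ { refl → irr refl })
                       (a≢b ∘ punchOut-injective v≢a v≢b)
                       dominates′
    where
    dominates′ : PairDominates (deleteVertex G v) (punchOut v≢a) (punchOut v≢b)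
    dominates′ w
      rewrite punchIn-punchOut v≢a | punchIn-punchOut v≢b = dominates (punchIn v w) (punchInᵢ≢i v w)

module Properties (q : ℕ) where

  m : ℕ
  m = 3 + q

  D : ℕ
  D = 2 * m ∸ 1

  D≡m-1+m : D ≡ (m ∸ 1) + m
  D≡m-1+m = cong ((m ∸ 1) +_) (+-identityʳ m)

  D+1≡2m : D + 1 ≡ 2 * m
  D+1≡2m = +-comm D 1

  n≡3+D+2m : 2 + 4 * m ≡ 3 + (D + 2 * m)
  n≡3+D+2m = trans (lem q) (cong (λ d → 3 + (d + 2 * m)) (sym D≡m-1+m))
    where
    lem : ∀ q → 2 + 4 * (3 + q) ≡ 3 + ((2 + q) + (3 + q) + 2 * (3 + q))
    lem = solve-∀

  m-1+m≡m+m-1 : (m ∸ 1) + m ≡ m + (m ∸ 1)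
  m-1+m≡m+m-1 = +-comm (m ∸ 1) m

  m≤D : m ≤ D
  m≤D = ≤-trans (m≤n+m m (m ∸ 1)) (≤-reflexive (sym D≡m-1+m))

  2m≡m+m : 2 * m ≡ m + m
  2m≡m+m = cong (m +_) (+-identityʳ m)

  ≤D⇒≤2m : ∀ {i} → i ≤ D → i ≤ 2 * m
  ≤D⇒≤2m i≤D = ≤-trans i≤D (n≤1+n D)

  ≤D⇒+1≤2m : ∀ {i} → i ≤ D → i + 1 ≤ 2 * m
  ≤D⇒+1≤2m {i} i≤D = ≤-trans (≤-reflexive (+-comm i 1)) (s≤s i≤D)

  ≤m⇒+m≤2m : ∀ {i} → i ≤ m → i + m ≤ 2 * m
  ≤m⇒+m≤2m i≤m = ≤-trans (+-monoˡ-≤ m i≤m) (≤-reflexive (sym 2m≡m+m))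

  1≤+ : ∀ {i} k → 1 ≤ i → 1 ≤ i + k
  1≤+ {i} k 1≤i = ≤-trans 1≤i (m≤m+n i k)

  1≤D : 1 ≤ D
  1≤D = ≤-trans (s≤s z≤n) m≤D

  m≢1 : m ≢ 1
  m≢1 ()

  1≤2m : 1 ≤ 2 * m
  1≤2m = ≤D⇒≤2m 1≤D

  data Valid : Vtx → Set where
    vX : Valid X
    vY : Valid Y
    vZ : Valid Z
    vYi : ∀ {i} → 1 ≤ i → i ≤ D → Valid (Yi i)
    vZi : ∀ {j} → 1 ≤ j → j ≤ 2 * m → Valid (Zi j)

  encodeℕ : Vtx → ℕ
  encodeℕ X      = 0
  encodeℕ Y      = 1
  encodeℕ Z      = 2
  encodeℕ (Yi i) = 2 + i
  encodeℕ (Zi j) = 3 + (D + (j ∸ 1))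

  decodeℕ-Yi : ∀ k → k < D → decodeℕ m (3 + k) ≡ Yi (suc k)
  decodeℕ-Yi k k<D with k <ᵇ D in eq
  ... | true  = refl
  ... | false = contradiction (subst T eq (<⇒<ᵇ k<D)) λ ()

  decodeℕ-Zi : ∀ t → decodeℕ m (3 + (D + t)) ≡ Zi (suc t)
  decodeℕ-Zi t with (D + t) <ᵇ D in eq
  ... | true  = contradiction (<ᵇ⇒< (D + t) D (subst T (sym eq) tt)) (≤⇒≯ (m≤m+n D t))
  ... | false = cong Zi (trans (cong (_∸ D) (sym (+-suc D t))) (m+n∸m≡n D (suc t)))

  decodeℕ-encodeℕ : ∀ {V} → Valid V → decodeℕ m (encodeℕ V) ≡ V
  decodeℕ-encodeℕ vX = refl
  decodeℕ-encodeℕ vY = refl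
  decodeℕ-encodeℕ vZ = refl
  decodeℕ-encodeℕ (vYi {suc i} _ i<D) = decodeℕ-Yi i i<D
  decodeℕ-encodeℕ (vZi {suc j} _ _) = decodeℕ-Zi j

  encodeℕ<n : ∀ {V} → Valid V → encodeℕ V < 2 + 4 * m
  encodeℕ<n vX = s≤s z≤n
  encodeℕ<n vY = s≤s (s≤s z≤n)
  encodeℕ<n vZ = s≤s (s≤s (s≤s z≤n))
  encodeℕ<n (vYi {i} _ i≤D) =
    subst (3 + i ≤_) (sym n≡3+D+2m) (+-monoʳ-≤ 3 (≤-trans i≤D (m≤m+n D (2 * m))))
  encodeℕ<n (vZi {suc j} _ j<2m) =
    subst (4 + (D + j) ≤_) (sym n≡3+D+2m) (+-monoʳ-≤ 3 (≤-trans (≤-reflexive (sym (+-suc D j))) (+-monoʳ-≤ D j<2m)))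

  decodeℕ-valid : ∀ k → k < 2 + 4 * m → Valid (decodeℕ m k) × encodeℕ (decodeℕ m k) ≡ k
  decodeℕ-valid 0 _ = vX , refl
  decodeℕ-valid 1 _ = vY , refl
  decodeℕ-valid 2 _ = vZ , refl
  decodeℕ-valid (suc (suc (suc k))) k<n with k <? D
  ... | yes k<D rewrite decodeℕ-Yi k k<D = vYi (s≤s z≤n) k<D , refl
  ... | no k≮D with t , refl ← m≤n⇒∃[o]m+o≡n (≮⇒≥ k≮D) rewrite decodeℕ-Zi t = vZi (s≤s z≤n) t<2m , refl
    where
    t<2m : t < 2 * m
    t<2m = +-cancelˡ-< D t (2 * m) (+-cancelˡ-≤ 3 _ _ (≤-trans k<n (≤-reflexive n≡3+D+2m)))

  decode-valid : (a : Fin (2 + 4 * m)) → Valid (decode m a)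
  decode-valid a = proj₁ (decodeℕ-valid (toℕ a) (toℕ<n a))

  decode-injective : ∀ {a b : Fin (2 + 4 * m)} → decode m a ≡ decode m b → a ≡ b
  decode-injective {a} {b} a≡b = toℕ-injective (begin
    toℕ a                      ≡⟨ sym (proj₂ (decodeℕ-valid (toℕ a) (toℕ<n a))) ⟩
    encodeℕ (decode m a)       ≡⟨ cong encodeℕ a≡b ⟩
    encodeℕ (decode m b)       ≡⟨ proj₂ (decodeℕ-valid (toℕ b) (toℕ<n b)) ⟩
    toℕ b                      ∎)
    where open ≡-Reasoning

  encode : ∀ {V} → Valid V → Fin (2 + 4 * m)
  encode v = fromℕ< (encodeℕ<n v)

  decode-encode : ∀ {V} (v : Valid V) → decode m (encode v) ≡ V
  decode-encode v = trans (cong (decodeℕ m) (toℕ-fromℕ< (encodeℕ<n v))) (decodeℕ-encodeℕ v)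

  Yi-injective : ∀ {a b} → Yi a ≡ Yi b → a ≡ b
  Yi-injective refl = refl

  Zi-injective : ∀ {a b} → Zi a ≡ Zi b → a ≡ b
  Zi-injective refl = refl

  σ : ℕ → ℕ
  σ i = 1 + ((i + m ∸ 2) % suc (2 * m ∸ 2))

  σ≡ : ∀ i → σ i ≡ 1 + ((i + (m ∸ 2)) % D)
  σ≡ i = cong (λ k → 1 + k % D) (+-∸-assoc i {m} (s≤s (s≤s z≤n)))

  m+[m∸2]<D : m + (m ∸ 2) < D
  m+[m∸2]<D = ≤-reflexive (trans (lem q) (sym D≡m-1+m))
    where
    lem : ∀ q → 1 + ((3 + q) + (1 + q)) ≡ (2 + q) + (3 + q)
    lem = solve-∀

  σ-small : ∀ {i} → i ≤ m → σ i ≡ i + (m ∸ 1)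
  σ-small {i} i≤m = begin
    σ i                         ≡⟨ σ≡ i ⟩
    1 + (i + (m ∸ 2)) % D       ≡⟨ cong suc (m<n⇒m%n≡m (≤-trans (s≤s (+-monoˡ-≤ (m ∸ 2) i≤m)) m+[m∸2]<D)) ⟩
    1 + (i + (m ∸ 2))           ≡⟨ sym (+-suc i (m ∸ 2)) ⟩
    i + (m ∸ 1)                 ∎
    where open ≡-Reasoning

  σ-large : ∀ {i} → m < i → i ≤ D → i ≡ σ i + m
  σ-large {i} m<i i≤D with t , refl ← m≤n⇒∃[o]m+o≡n m<i = begin
    suc m + t                        ≡⟨ cong suc (+-comm m t) ⟩
    1 + t + m                        ≡⟨ cong (λ k → 1 + k + m) (sym (m<n⇒m%n≡m t<D)) ⟩
    1 + (t % D) + m                  ≡⟨ cong (λ k → 1 + k + m) (sym ([m+n]%n≡m%n t D)) ⟩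
    1 + ((t + D) % D) + m            ≡⟨ cong (λ k → 1 + (k % D) + m) t+D≡ ⟩
    1 + ((suc m + t + (m ∸ 2)) % D) + m ≡⟨ cong (_+ m) (sym (σ≡ (suc m + t))) ⟩
    σ (suc m + t) + m                ∎
    where
    open ≡-Reasoning
    t<D : t < D
    t<D = ≤-trans (s≤s (m≤n+m t m)) i≤D
    t+D≡ : t + D ≡ suc m + t + (m ∸ 2)
    t+D≡ = trans (cong (t +_) D≡m-1+m) (lem t q)
      where
      lem : ∀ t q → t + ((2 + q) + (3 + q)) ≡ (4 + q) + t + (1 + q)
      lem = solve-∀

  H : Vtx → Vtx → Set
  H V W = Edge m V W ⊎ Edge m W V

  H-sym : ∀ {V W} → H V W → H W V
  H-sym = swap

  Gap : ℕ → ℕ → Set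
  Gap a b = b ≡ a + (m ∸ 1) ⊎ b ≡ a + m

  gap⇒< : ∀ {a b} → Gap a b → a < b
  gap⇒< {a} (inj₁ refl) = m<m+n a (s≤s z≤n)
  gap⇒< {a} (inj₂ refl) = m<m+n a (s≤s z≤n)

  yi-yi⁻ : ∀ {a b} → H (Yi a) (Yi b) → Gap a b ⊎ Gap b a
  yi-yi⁻ (inj₁ e) = edge-gap e
    where
    edge-gap : ∀ {a b} → Edge m (Yi a) (Yi b) → Gap a b ⊎ Gap b a
    edge-gap (e-yiyi {i} _ i≤D) with i ≤? m
    ... | yes i≤m = inj₁ (inj₁ (σ-small i≤m))
    ... | no  i≰m = inj₂ (inj₂ (σ-large (≰⇒> i≰m) i≤D))
  yi-yi⁻ (inj₂ e) = swap (yi-yi⁻ (inj₁ e))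

  yi-yi : ∀ {a b} → 1 ≤ a → b ≤ D → Gap a b → H (Yi a) (Yi b)
  yi-yi {a} 1≤a b≤D (inj₁ refl) =
    inj₁ (subst (Edge m (Yi a) ∘ Yi) (σ-small a≤m) (e-yiyi 1≤a (≤-trans (m≤m+n a _) b≤D)))
    where
    a≤m : a ≤ m
    a≤m = +-cancelʳ-≤ (m ∸ 1) a m (≤-trans b≤D (≤-reflexive (trans D≡m-1+m m-1+m≡m+m-1)))
  yi-yi {a} 1≤a b≤D (inj₂ refl) =
    inj₂ (subst (Edge m (Yi (a + m)) ∘ Yi) σb≡a (e-yiyi (≤-trans 1≤a (m≤m+n a m)) b≤D))
    where
    σb≡a : σ (a + m) ≡ a
    σb≡a = +-cancelʳ-≡ m (σ (a + m)) a (sym (σ-large (m<n+m m 1≤a) b≤D))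

  yi-zi : ∀ {i j} → 1 ≤ i → i ≤ D → 1 ≤ j → j ≤ 2 * m → j ≢ i → j ≢ i + 1 → H (Yi i) (Zi j)
  yi-zi 1≤i i≤D 1≤j j≤2m j≢i j≢i+1 = inj₁ (e-yizj 1≤i i≤D 1≤j j≤2m j≢i j≢i+1)

  yi-zi⁻ : ∀ {i j} → H (Yi i) (Zi j) → j ≢ i × j ≢ i + 1
  yi-zi⁻ (inj₁ (e-yizj _ _ _ _ j≢i j≢i+1)) = j≢i , j≢i+1

  zi-zi : ∀ {a b} → 1 ≤ a → a ≤ 2 * m → 1 ≤ b → b ≤ 2 * m →
          a ≢ b → b ≢ a + m → a ≢ b + m → H (Zi a) (Zi b)
  zi-zi {a} {b} 1≤a a≤2m 1≤b b≤2m a≢b b≢a+m a≢b+m with <-cmp a b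
  ... | tri< a<b _ _ = inj₁ (e-zizj 1≤a a<b b≤2m b≢a+m)
  ... | tri≈ _ a≡b _ = contradiction a≡b a≢b
  ... | tri> _ _ b<a = inj₂ (e-zizj 1≤b b<a a≤2m a≢b+m)

  zi-zi⁻ : ∀ {a b} → H (Zi a) (Zi b) → a ≢ b × b ≢ a + m × a ≢ b + m
  zi-zi⁻ (inj₁ (e-zizj {a} {b} _ a<b _ b≢a+m)) =
    <⇒≢ a<b , b≢a+m , λ a≡b+m → <⇒≱ a<b (≤-trans (m≤m+n b m) (≤-reflexive (sym a≡b+m)))
  zi-zi⁻ (inj₂ (e-zizj {b} {a} _ b<a _ a≢b+m)) =
    ≢-sym (<⇒≢ b<a) , (λ b≡a+m → <⇒≱ b<a (≤-trans (m≤m+n a m) (≤-reflexive (sym b≡a+m)))) , a≢b+m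

  H-irreflexive : ∀ {V} → ¬ H V V
  H-irreflexive {X}    = λ { (inj₁ ()) ; (inj₂ ()) }
  H-irreflexive {Y}    = λ { (inj₁ ()) ; (inj₂ ()) }
  H-irreflexive {Z}    = λ { (inj₁ ()) ; (inj₂ ()) }
  H-irreflexive {Yi a} h with yi-yi⁻ h
  ... | inj₁ gap = <-irrefl refl (gap⇒< gap)
  ... | inj₂ gap = <-irrefl refl (gap⇒< gap)
  H-irreflexive {Zi a} h = proj₁ (zi-zi⁻ h) refl

  gap-suc-right : ∀ {a b} → Gap a b → Gap a (suc b) → suc b ≡ a + m
  gap-suc-right (inj₁ refl) (inj₁ e) = contradiction e 1+n≢n
  gap-suc-right (inj₁ refl) (inj₂ e) = e
  gap-suc-right {a} (inj₂ refl) (inj₁ e) = contradiction (sym e) (<⇒≢ (s≤s (+-monoʳ-≤ a (n≤1+n (m ∸ 1)))))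
  gap-suc-right (inj₂ refl) (inj₂ e) = contradiction e 1+n≢n

  gap-suc-left : ∀ {a b} → Gap a b → Gap (suc a) b → b ≡ a + m
  gap-suc-left (inj₂ e) _ = e
  gap-suc-left (inj₁ refl) (inj₁ e) = contradiction (sym e) 1+n≢n
  gap-suc-left {a} (inj₁ refl) (inj₂ e) = contradiction e (<⇒≢ (s≤s (+-monoʳ-≤ a (n≤1+n (m ∸ 1)))))

  consecutive-y-neighbours : ∀ {i k} → Gap i k ⊎ Gap k i → Gap i (suc k) ⊎ Gap (suc k) i →
                             suc k ≡ i + m ⊎ i ≡ k + m
  consecutive-y-neighbours (inj₁ ik) (inj₁ ik′) = inj₁ (gap-suc-right ik ik′)
  consecutive-y-neighbours (inj₂ ki) (inj₂ k′i) = inj₂ (gap-suc-left ki k′i)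
  consecutive-y-neighbours (inj₁ ik) (inj₂ k′i) = contradiction (<-trans (gap⇒< ik) (n<1+n _)) (<-asym (gap⇒< k′i))
  consecutive-y-neighbours (inj₂ ki) (inj₁ ik′) = contradiction (gap⇒< ki) (≤⇒≯ (s≤s⁻¹ (gap⇒< ik′)))

  Dominates : Vtx → Vtx → Set
  Dominates A B = ∀ {W} → Valid W → H W A ⊎ H W B

  dominated-by-first : ∀ {A B W} → Dominates A B → Valid W → ¬ H W B → H W A
  dominated-by-first dominates w ¬WB with dominates w
  ... | inj₁ WA = WA
  ... | inj₂ WB = contradiction WB ¬WB

  dominated-by-second : ∀ {A B W} → Dominates A B → Valid W → ¬ H W A → H W B
  dominated-by-second dominates w ¬WA with dominates w
  ... | inj₁ WA = contradiction WA ¬WA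
  ... | inj₂ WB = WB

  ¬dominates-z-y : ¬ Dominates Z Y
  ¬dominates-z-y dominates with dominates vX
  ... | inj₁ (inj₁ ())
  ... | inj₁ (inj₂ ())
  ... | inj₂ (inj₁ ())
  ... | inj₂ (inj₂ ())

  ¬dominates-yi-y : ∀ {i} → 1 ≤ i → i ≤ D → ¬ Dominates (Yi i) Y
  ¬dominates-yi-y 1≤i i≤D dominates with dominates (vZi 1≤i (≤D⇒≤2m i≤D))
  ... | inj₁ zᵢ-yᵢ = proj₁ (yi-zi⁻ (H-sym zᵢ-yᵢ)) refl
  ... | inj₂ (inj₁ ())
  ... | inj₂ (inj₂ ())

  ¬dominates-z-zi : ∀ {j} → 1 ≤ j → j ≤ 2 * m → ¬ Dominates Z (Zi j)
  ¬dominates-z-zi {suc zero} _ _ dominates with dominates (vYi ≤-refl 1≤D)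
  ... | inj₁ (inj₁ ())
  ... | inj₁ (inj₂ ())
  ... | inj₂ y₁-z₁ = proj₁ (yi-zi⁻ y₁-z₁) refl
  ¬dominates-z-zi {suc (suc k)} _ (s≤s j≤D) dominates with dominates (vYi (s≤s z≤n) j≤D)
  ... | inj₁ (inj₁ ())
  ... | inj₁ (inj₂ ())
  ... | inj₂ yₖ-zₖ₊₁ = proj₂ (yi-zi⁻ yₖ-zₖ₊₁) (+-comm 1 (suc k))

  ¬dominates-yi-z1 : ∀ {i} → 1 ≤ i → i ≤ D → ¬ Dominates (Yi i) (Zi 1)
  ¬dominates-yi-z1 {i} 1≤i i≤D dominates with yi-yi⁻ y₁-yi | yi-zi⁻ (H-sym z₁₊ₘ-yi)
    where
    y₁-yi : H (Yi 1) (Yi i)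
    y₁-yi = dominated-by-first dominates (vYi ≤-refl (≤-trans 1≤i i≤D)) (λ h → proj₁ (yi-zi⁻ h) refl)
    z₁₊ₘ-yi : H (Zi (1 + m)) (Yi i)
    z₁₊ₘ-yi = dominated-by-first dominates (vZi (s≤s z≤n) (≤m⇒+m≤2m (s≤s z≤n)))
                (λ h → proj₂ (proj₂ (zi-zi⁻ h)) refl)
  ... | inj₁ (inj₁ i≡m)   | _ , 1+m≢i+1 = 1+m≢i+1 (trans (+-comm 1 m) (cong (_+ 1) (sym i≡m)))
  ... | inj₁ (inj₂ i≡1+m) | 1+m≢i , _   = 1+m≢i (sym i≡1+m)
  ... | inj₂ gap          | _           = <⇒≱ (gap⇒< gap) 1≤i

  ¬dominates-yi-z2m : ∀ {i} → 1 ≤ i → i ≤ D → ¬ Dominates (Yi i) (Zi (2 * m))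
  ¬dominates-yi-z2m {i} 1≤i i≤D dominates with yi-yi⁻ (H-sym y_D-yi) | yi-zi⁻ (H-sym zₘ-yi)
    where
    y_D-yi : H (Yi D) (Yi i)
    y_D-yi = dominated-by-first dominates (vYi (≤-trans 1≤i i≤D) ≤-refl)
               (λ h → proj₂ (yi-zi⁻ h) (sym D+1≡2m))
    zₘ-yi : H (Zi m) (Yi i)
    zₘ-yi = dominated-by-first dominates (vZi (s≤s z≤n) (≤D⇒≤2m m≤D))
              (λ h → proj₁ (proj₂ (zi-zi⁻ h)) 2m≡m+m)
  ... | inj₁ (inj₁ D≡i+m-1) | m≢i , _ =
    m≢i (+-cancelʳ-≡ (m ∸ 1) m i (trans (sym (trans D≡m-1+m m-1+m≡m+m-1)) D≡i+m-1))
  ... | inj₁ (inj₂ D≡i+m) | _ , m≢i+1 =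
    m≢i+1 (trans (+-comm 1 (m ∸ 1)) (cong (_+ 1) (+-cancelʳ-≡ m (m ∸ 1) i (trans (sym D≡m-1+m) D≡i+m))))
  ... | inj₂ gap | _ = <⇒≱ (gap⇒< gap) i≤D

  ¬dominates-yi-zj : ∀ {i k} → 1 ≤ i → i ≤ D → 1 ≤ k → suc k ≤ D → ¬ Dominates (Yi i) (Zi (suc k))
  ¬dominates-yi-zj {i} {k} 1≤i i≤D 1≤k k<D dominates
    with consecutive-y-neighbours (yi-yi⁻ (H-sym yₖ-yi)) (yi-yi⁻ (H-sym yₖ₊₁-yi))
       | zi-zi⁻ zᵢ-zₖ₊₁ | zi-zi⁻ zᵢ₊₁-zₖ₊₁
    where
    yₖ-yi : H (Yi k) (Yi i)
    yₖ-yi = dominated-by-first dominates (vYi 1≤k (≤-trans (n≤1+n k) k<D))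
              (λ h → proj₂ (yi-zi⁻ h) (+-comm 1 k))
    yₖ₊₁-yi : H (Yi (suc k)) (Yi i)
    yₖ₊₁-yi = dominated-by-first dominates (vYi (s≤s z≤n) k<D) (λ h → proj₁ (yi-zi⁻ h) refl)
    zᵢ-zₖ₊₁ : H (Zi i) (Zi (suc k))
    zᵢ-zₖ₊₁ = dominated-by-second dominates (vZi 1≤i (≤D⇒≤2m i≤D))
                (λ h → proj₁ (yi-zi⁻ (H-sym h)) refl)
    zᵢ₊₁-zₖ₊₁ : H (Zi (i + 1)) (Zi (suc k))
    zᵢ₊₁-zₖ₊₁ = dominated-by-second dominates (vZi (1≤+ 1 1≤i) (≤D⇒+1≤2m i≤D))
                  (λ h → proj₂ (yi-zi⁻ (H-sym h)) refl)
  ... | inj₁ k+1≡i+m | _ , k+1≢i+m , _ | _ = k+1≢i+m k+1≡i+m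
  ... | inj₂ i≡k+m   | _ | _ , _ , i+1≢k+1+m = i+1≢k+1+m (trans (+-comm i 1) (cong suc i≡k+m))

  ¬dominates-yi-zi : ∀ {i j} → 1 ≤ i → i ≤ D → 1 ≤ j → j ≤ 2 * m → ¬ Dominates (Yi i) (Zi j)
  ¬dominates-yi-zi 1≤i i≤D (s≤s {n = zero} z≤n) _ = ¬dominates-yi-z1 1≤i i≤D
  ¬dominates-yi-zi {j = suc (suc k)} 1≤i i≤D _ j≤2m with suc (suc k) ≤? D
  ... | yes j≤D = ¬dominates-yi-zj 1≤i i≤D (s≤s z≤n) j≤D
  ... | no  j≰D rewrite ≤-antisym j≤2m (≰⇒> j≰D) = ¬dominates-yi-z2m 1≤i i≤D

  y-z-neighbours-separated : ∀ {A B} → H Y A → H Z B → A ≢ B × ¬ Dominates A B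
  y-z-neighbours-separated (inj₁ e-yz)            (inj₂ e-yz)             = (λ ()) , ¬dominates-z-y
  y-z-neighbours-separated (inj₂ (e-yiy 1≤i i≤D)) (inj₂ e-yz)             = (λ ()) , ¬dominates-yi-y 1≤i i≤D
  y-z-neighbours-separated (inj₁ e-yz)            (inj₂ (e-ziz 1≤j j≤2m)) = (λ ()) , ¬dominates-z-zi 1≤j j≤2m
  y-z-neighbours-separated (inj₂ (e-yiy 1≤i i≤D)) (inj₂ (e-ziz 1≤j j≤2m)) =
    (λ ()) , ¬dominates-yi-zi 1≤i i≤D 1≤j j≤2m

  record DominatingPair (V : Vtx) : Set where
    field
      P Q       : Vtx
      valid-P   : Valid P
      valid-Q   : Valid Q
      P≢V       : P ≢ V
      Q≢V       : Q ≢ V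
      P≢Q       : P ≢ Q
      dominates : ∀ {W} → Valid W → W ≢ V → H W P ⊎ H W Q

  dominating-pair-x : DominatingPair X
  dominating-pair-x = record
    { P = Y ; Q = Z ; valid-P = vY ; valid-Q = vZ
    ; P≢V = λ () ; Q≢V = λ () ; P≢Q = λ () ; dominates = dominates }
    where
    dominates : ∀ {W} → Valid W → W ≢ X → H W Y ⊎ H W Z
    dominates vX              W≢X = contradiction refl W≢X
    dominates vY              _   = inj₂ (inj₁ e-yz)
    dominates vZ              _   = inj₁ (inj₂ e-yz)
    dominates (vYi 1≤i i≤D)   _   = inj₁ (inj₁ (e-yiy 1≤i i≤D))
    dominates (vZi 1≤j j≤2m)  _   = inj₂ (inj₁ (e-ziz 1≤j j≤2m))

  dominating-pair-y : DominatingPair Y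
  dominating-pair-y = record
    { P = X ; Q = Zi 1 ; valid-P = vX ; valid-Q = vZi ≤-refl 1≤2m
    ; P≢V = λ () ; Q≢V = λ () ; P≢Q = λ () ; dominates = dominates }
    where
    dominates : ∀ {W} → Valid W → W ≢ Y → H W X ⊎ H W (Zi 1)
    dominates vX              _   = inj₂ (inj₁ (e-xzi ≤-refl 1≤2m))
    dominates vY              W≢Y = contradiction refl W≢Y
    dominates vZ              _   = inj₂ (inj₂ (e-ziz ≤-refl 1≤2m))
    dominates (vYi 1≤i i≤D)   _   = inj₁ (inj₂ (e-xyi 1≤i i≤D))
    dominates (vZi 1≤j j≤2m)  _   = inj₁ (inj₂ (e-xzi 1≤j j≤2m))

  dominating-pair-z : DominatingPair Z
  dominating-pair-z = record
    { P = X ; Q = Yi 1 ; valid-P = vX ; valid-Q = vYi ≤-refl 1≤D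
    ; P≢V = λ () ; Q≢V = λ () ; P≢Q = λ () ; dominates = dominates }
    where
    dominates : ∀ {W} → Valid W → W ≢ Z → H W X ⊎ H W (Yi 1)
    dominates vX              _   = inj₂ (inj₁ (e-xyi ≤-refl 1≤D))
    dominates vY              _   = inj₂ (inj₂ (e-yiy ≤-refl 1≤D))
    dominates vZ              W≢Z = contradiction refl W≢Z
    dominates (vYi 1≤i i≤D)   _   = inj₁ (inj₂ (e-xyi 1≤i i≤D))
    dominates (vZi 1≤j j≤2m)  _   = inj₁ (inj₂ (e-xzi 1≤j j≤2m))

  dominating-pair-zi-small : ∀ {j} → 1 ≤ j → j ≤ m → DominatingPair (Zi j)
  dominating-pair-zi-small {j} 1≤j j≤m = record
    { P = Yi j ; Q = Zi (j + m) ; valid-P = vYi 1≤j j≤D ; valid-Q = vZi (1≤+ m 1≤j) j+m≤2m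
    ; P≢V = λ () ; Q≢V = m+1+n≢m j ∘ Zi-injective ; P≢Q = λ () ; dominates = dominates }
    where
    j≤D : j ≤ D
    j≤D = ≤-trans j≤m m≤D
    j+m≤2m : j + m ≤ 2 * m
    j+m≤2m = ≤m⇒+m≤2m j≤m
    dominates : ∀ {W} → Valid W → W ≢ Zi j → H W (Yi j) ⊎ H W (Zi (j + m))
    dominates vX _ = inj₁ (inj₁ (e-xyi 1≤j j≤D))
    dominates vY _ = inj₁ (inj₂ (e-yiy 1≤j j≤D))
    dominates vZ _ = inj₂ (inj₂ (e-ziz (1≤+ m 1≤j) j+m≤2m))
    dominates (vYi {k} 1≤k k≤D) _ with k ≟ j + m | k + 1 ≟ j + m
    ... | yes refl | _ = inj₁ (H-sym (yi-yi 1≤j k≤D (inj₂ refl)))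
    ... | no _ | yes k+1≡j+m =
      inj₁ (H-sym (yi-yi 1≤j k≤D (inj₁ (suc-injective (trans (+-comm 1 k) (trans k+1≡j+m (+-suc j (m ∸ 1))))))))
    ... | no k≢j+m | no k+1≢j+m = inj₂ (yi-zi 1≤k k≤D (1≤+ m 1≤j) j+m≤2m (k≢j+m ∘ sym) (k+1≢j+m ∘ sym))
    dominates (vZi {k} 1≤k k≤2m) Zk≢Zj with k ≟ j + m
    ... | yes refl = inj₁ (H-sym (yi-zi 1≤j j≤D (1≤+ m 1≤j) j+m≤2m (m+1+n≢m j)
                                        (λ j+m≡j+1 → m≢1 (+-cancelˡ-≡ j m 1 j+m≡j+1))))
    ... | no k≢j+m = inj₂ (zi-zi 1≤k k≤2m (1≤+ m 1≤j) j+m≤2m k≢j+m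
                                   (λ j+m≡k+m → Zk≢Zj (cong Zi (sym (+-cancelʳ-≡ m j k j+m≡k+m))))
                                   (λ k≡j+m+m → <⇒≱ (2m<j+m+m) (≤-trans (≤-reflexive (sym k≡j+m+m)) k≤2m)))
      where
      2m<j+m+m : 2 * m < j + m + m
      2m<j+m+m = ≤-trans (≤-reflexive (cong suc 2m≡m+m)) (+-monoˡ-≤ m (+-monoˡ-≤ m 1≤j))

  dominating-pair-zi-large : ∀ {a} → 1 ≤ a → a ≤ m → DominatingPair (Zi (m + a))
  dominating-pair-zi-large {a} 1≤a a≤m = record
    { P = Yi e ; Q = Zi a ; valid-P = vYi (1≤+ (m ∸ 1) 1≤a) e≤D ; valid-Q = vZi 1≤a a≤2m
    ; P≢V = λ () ; Q≢V = λ Za≡Zm+a → m+1+n≢m a (trans (+-comm a m) (sym (Zi-injective Za≡Zm+a)))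
    ; P≢Q = λ () ; dominates = dominates }
    where
    e : ℕ
    e = a + (m ∸ 1)
    e≤D : e ≤ D
    e≤D = ≤-trans (+-monoˡ-≤ (m ∸ 1) a≤m) (≤-reflexive (sym (trans D≡m-1+m m-1+m≡m+m-1)))
    a≤2m : a ≤ 2 * m
    a≤2m = ≤D⇒≤2m (≤-trans a≤m m≤D)
    a<e : a < e
    a<e = m<m+n a (s≤s z≤n)
    dominates : ∀ {W} → Valid W → W ≢ Zi (m + a) → H W (Yi e) ⊎ H W (Zi a)
    dominates vX _ = inj₁ (inj₁ (e-xyi (1≤+ (m ∸ 1) 1≤a) e≤D))
    dominates vY _ = inj₁ (inj₂ (e-yiy (1≤+ (m ∸ 1) 1≤a) e≤D))
    dominates vZ _ = inj₂ (inj₂ (e-ziz 1≤a a≤2m))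
    dominates (vYi {k} 1≤k k≤D) _ with k ≟ a | k + 1 ≟ a
    ... | yes refl | _ = inj₁ (yi-yi 1≤k e≤D (inj₁ refl))
    ... | no _ | yes refl = inj₁ (yi-yi 1≤k e≤D (inj₂ (+-assoc k 1 (m ∸ 1))))
    ... | no k≢a | no k+1≢a = inj₂ (yi-zi 1≤k k≤D 1≤a a≤2m (k≢a ∘ sym) (k+1≢a ∘ sym))
    dominates (vZi {k} 1≤k k≤2m) Zk≢Zm+a with k ≟ a
    ... | yes refl = inj₁ (H-sym (yi-zi (1≤+ (m ∸ 1) 1≤a) e≤D 1≤a a≤2m
                                        (<⇒≢ a<e) (<⇒≢ (<-trans a<e (m<m+n e (s≤s z≤n))))))
    ... | no k≢a = inj₂ (zi-zi 1≤k k≤2m 1≤a a≤2m k≢a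
                                (λ a≡k+m → <⇒≱ (m<n+m m 1≤k) (≤-trans (≤-reflexive (sym a≡k+m)) a≤m))
                                (λ k≡a+m → Zk≢Zm+a (cong Zi (trans k≡a+m (+-comm a m)))))

  dominating-pair-yi-small : ∀ {i} → suc i ≤ m → DominatingPair (Yi (suc i))
  dominating-pair-yi-small {i} i<m = record
    { P = Yi c ; Q = Zi (suc i) ; valid-P = vYi 1≤c c≤D ; valid-Q = vZi (s≤s z≤n) i+1≤2m
    ; P≢V = λ Yc≡Yi+1 → <⇒≢ i+1<c (sym (Yi-injective Yc≡Yi+1))
    ; Q≢V = λ () ; P≢Q = λ () ; dominates = dominates }
    where
    c : ℕ
    c = i + (m ∸ 1)
    1≤c : 1 ≤ c
    1≤c = ≤-trans (s≤s z≤n) (m≤n+m (m ∸ 1) i)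
    c≤D : c ≤ D
    c≤D = ≤-trans (+-monoˡ-≤ (m ∸ 1) (≤-trans (n≤1+n i) i<m))
                  (≤-reflexive (sym (trans D≡m-1+m m-1+m≡m+m-1)))
    i+1≤2m : suc i ≤ 2 * m
    i+1≤2m = ≤D⇒≤2m (≤-trans i<m m≤D)
    i+1<c : suc i < c
    i+1<c = ≤-trans (≤-reflexive (+-comm 2 i)) (+-monoʳ-≤ i (s≤s (s≤s z≤n)))
    i+1+m≡c+2 : suc i + m ≡ suc (suc c)
    i+1+m≡c+2 = cong suc (+-suc i (m ∸ 1))
    dominates : ∀ {W} → Valid W → W ≢ Yi (suc i) → H W (Yi c) ⊎ H W (Zi (suc i))
    dominates vX _ = inj₂ (inj₁ (e-xzi (s≤s z≤n) i+1≤2m))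
    dominates vY _ = inj₁ (inj₂ (e-yiy 1≤c c≤D))
    dominates vZ _ = inj₂ (inj₂ (e-ziz (s≤s z≤n) i+1≤2m))
    dominates (vYi {k} 1≤k k≤D) Yk≢Yi+1 with k ≟ i
    ... | yes refl = inj₁ (yi-yi 1≤k c≤D (inj₁ refl))
    ... | no k≢i = inj₂ (yi-zi 1≤k k≤D (s≤s z≤n) i+1≤2m (Yk≢Yi+1 ∘ cong Yi ∘ sym)
                                (λ i+1≡k+1 → k≢i (sym (suc-injective (trans i+1≡k+1 (+-comm k 1))))))
    dominates (vZi {k} 1≤k k≤2m) _ with k ≟ suc i | k ≟ suc i + m
    ... | yes refl | _ = inj₁ (H-sym (yi-zi 1≤c c≤D (s≤s z≤n) i+1≤2m
                                        (<⇒≢ i+1<c) (<⇒≢ (<-trans i+1<c (m<m+n c (s≤s z≤n))))))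
    ... | no _ | yes refl = inj₁ (H-sym (yi-zi 1≤c c≤D 1≤k k≤2m
                                          (>⇒≢ (≤-trans (n≤1+n _) (≤-reflexive (sym i+1+m≡c+2))))
                                          (>⇒≢ (≤-trans (≤-reflexive (cong suc (+-comm c 1))) (≤-reflexive (sym i+1+m≡c+2))))))
    ... | no k≢i+1 | no k≢i+1+m =
      inj₂ (zi-zi 1≤k k≤2m (s≤s z≤n) i+1≤2m k≢i+1
                  (λ i+1≡k+m → <⇒≱ (m<n+m m 1≤k) (≤-trans (≤-reflexive (sym i+1≡k+m)) i<m))
                  k≢i+1+m)

  dominating-pair-yi-large : ∀ t → suc m + t ≤ D → DominatingPair (Yi (suc m + t))
  dominating-pair-yi-large t i≤D = record
    { P = Yi c ; Q = Zi (i + 1) ; valid-P = vYi (s≤s z≤n) c≤D ; valid-Q = vZi 1≤i+1 i+1≤2m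
    ; P≢V = λ Yc≡Yi → <⇒≢ c<i (Yi-injective Yc≡Yi)
    ; Q≢V = λ () ; P≢Q = λ () ; dominates = dominates }
    where
    i c : ℕ
    i = suc m + t
    c = 3 + t
    1≤i+1 : 1 ≤ i + 1
    1≤i+1 = 1≤+ {i} 1 (s≤s z≤n)
    c<i : c < i
    c<i = +-monoˡ-< t (s≤s (s≤s (s≤s (s≤s z≤n))))
    c≤D : c ≤ D
    c≤D = ≤-trans (<⇒≤ c<i) i≤D
    i+1≤2m : i + 1 ≤ 2 * m
    i+1≤2m = ≤D⇒+1≤2m i≤D
    i+1≡c+m-1 : i + 1 ≡ c + (m ∸ 1)
    i+1≡c+m-1 = lemma q t
      where
      lemma : ∀ q t → suc (3 + q) + t + 1 ≡ 3 + t + (2 + q)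
      lemma = solve-∀
    dominates : ∀ {W} → Valid W → W ≢ Yi i → H W (Yi c) ⊎ H W (Zi (i + 1))
    dominates vX _ = inj₂ (inj₁ (e-xzi 1≤i+1 i+1≤2m))
    dominates vY _ = inj₁ (inj₂ (e-yiy (s≤s z≤n) c≤D))
    dominates vZ _ = inj₂ (inj₂ (e-ziz 1≤i+1 i+1≤2m))
    dominates (vYi {k} 1≤k k≤D) Yk≢Yi with k ≟ i + 1
    ... | yes refl = inj₁ (H-sym (yi-yi (s≤s z≤n) k≤D (inj₁ i+1≡c+m-1)))
    ... | no k≢i+1 = inj₂ (yi-zi 1≤k k≤D 1≤i+1 i+1≤2m (k≢i+1 ∘ sym)
                                  (λ i+1≡k+1 → Yk≢Yi (cong Yi (sym (+-cancelʳ-≡ 1 i k i+1≡k+1)))))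
    dominates (vZi {k} 1≤k k≤2m) _ with k ≟ i + 1 | k + 1 ≟ c
    ... | yes refl | _ = inj₁ (H-sym (yi-zi (s≤s z≤n) c≤D 1≤i+1 i+1≤2m
                                        (>⇒≢ (<-trans c<i (m<m+n i (s≤s z≤n))))
                                        (>⇒≢ (+-monoˡ-< 1 c<i))))
    ... | no _ | yes k+1≡c = inj₁ (H-sym (yi-zi (s≤s z≤n) c≤D 1≤k k≤2m
                                           (<⇒≢ k<c) (<⇒≢ (<-trans k<c (m<m+n c (s≤s z≤n))))))
      where
      k<c : k < c
      k<c = ≤-reflexive (trans (+-comm 1 k) k+1≡c)
    ... | no k≢i+1 | no k+1≢c =
      inj₂ (zi-zi 1≤k k≤2m 1≤i+1 i+1≤2m k≢i+1
                  (λ i+1≡k+m → k+1≢c (+-cancelʳ-≡ (m ∸ 1) (k + 1) c (trans (k+1+m-1≡k+m k) (trans (sym i+1≡k+m) i+1≡c+m-1))))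
                  (λ k≡i+1+m → <⇒≱ 2m<i+1+m (≤-trans (≤-reflexive (sym k≡i+1+m)) k≤2m)))
      where
      2m<i+1+m : 2 * m < i + 1 + m
      2m<i+1+m = ≤-trans (≤-reflexive (cong suc 2m≡m+m))
                         (+-monoˡ-≤ m (≤-trans (m≤m+n (suc m) t) (m≤m+n i 1)))
      k+1+m-1≡k+m : ∀ k → k + 1 + (m ∸ 1) ≡ k + m
      k+1+m-1≡k+m k = +-assoc k 1 (m ∸ 1)

  dominating-pair : ∀ {V} → Valid V → DominatingPair V
  dominating-pair vX = dominating-pair-x
  dominating-pair vY = dominating-pair-y
  dominating-pair vZ = dominating-pair-z
  dominating-pair (vYi {suc i} _ i<D) with suc i ≤? m
  ... | yes i<m = dominating-pair-yi-small i<m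
  ... | no  i≮m with t , refl ← m≤n⇒∃[o]m+o≡n (≰⇒> i≮m) = dominating-pair-yi-large t i<D
  dominating-pair (vZi {j} 1≤j j≤2m) with j ≤? m
  ... | yes j≤m = dominating-pair-zi-small 1≤j j≤m
  ... | no  j≰m with a , refl ← m≤n⇒∃[o]m+o≡n (<⇒≤ (≰⇒> j≰m)) =
    dominating-pair-zi-large (+-cancelˡ-≤ m 1 a (subst (_≤ m + a) (+-comm 1 m) (≰⇒> j≰m)))
                             (+-cancelˡ-≤ m a m (≤-trans j≤2m (≤-reflexive 2m≡m+m)))

  G4m2-irreflexive : Irreflexive _≡_ (G4m2 m)
  G4m2-irreflexive refl = H-irreflexive

  ¬dominates⇒¬pairDominates : ∀ {a b} → ¬ Dominates (decode m a) (decode m b) → ¬ PairDominates (G4m2 m) a b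
  ¬dominates⇒¬pairDominates {a} {b} ¬dominates dominates = ¬dominates λ w →
    subst (λ W → H W (decode m a) ⊎ H W (decode m b)) (decode-encode w) (dominates (encode w))

  -- {x, y, y₁} in the vertex layout of Defs.
  xyy₁ : Subset (2 + 4 * m)
  xyy₁ = inside ∷ inside ∷ outside ∷ inside ∷ ⊥

  xyy₁-dominates : ∀ {W} → Valid W → ∃ λ u → u ∈ xyy₁ × H W (decode m u)
  xyy₁-dominates vX              = fsuc (fsuc (fsuc fzero)) , there (there (there here)) , inj₁ (e-xyi ≤-refl 1≤D)
  xyy₁-dominates vY              = fsuc (fsuc (fsuc fzero)) , there (there (there here)) , inj₂ (e-yiy ≤-refl 1≤D)
  xyy₁-dominates vZ              = fsuc fzero , there here , inj₂ e-yz
  xyy₁-dominates (vYi 1≤i i≤D)   = fzero , here , inj₂ (e-xyi 1≤i i≤D)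
  xyy₁-dominates (vZi 1≤j j≤2m)  = fzero , here , inj₂ (e-xzi 1≤j j≤2m)

  γₜ≡3 : TotalDomNumber (G4m2 m) 3
  γₜ≡3 = (xyy₁ , xyy₁-dominates ∘ decode-valid , cong (3 +_) (∣⊥∣≡0 (q + 3 * m))) ,
         λ S → 3≤∣tds∣ (fsuc fzero) (fsuc (fsuc fzero)) separated
    where
    separated : ∀ {a b} → G4m2 m (fsuc fzero) a → G4m2 m (fsuc (fsuc fzero)) b →
                a ≢ b × ¬ PairDominates (G4m2 m) a b
    separated {a} {b} ya zb with y-z-neighbours-separated ya zb
    ... | A≢B , ¬dominates = A≢B ∘ cong (decode m) , ¬dominates⇒¬pairDominates {a} {b} ¬dominates

  γₜ[G-v]≡2 : (v : Fin (2 + 4 * m)) → TotalDomNumber (deleteVertex (G4m2 m) v) 2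
  γₜ[G-v]≡2 v = deleteVertex-γₜ≡2 G4m2-irreflexive (≢encode valid-P P≢V) (≢encode valid-Q Q≢V)
                  (P≢Q ∘ encode-injective) dominates′
    where
    open DominatingPair (dominating-pair (decode-valid v))
    ≢encode : ∀ {U} (u : Valid U) → U ≢ decode m v → v ≢ encode u
    ≢encode u U≢v refl = U≢v (sym (decode-encode u))
    encode-injective : encode valid-P ≡ encode valid-Q → P ≡ Q
    encode-injective e = trans (sym (decode-encode valid-P)) (trans (cong (decode m) e) (decode-encode valid-Q))
    dominates′ : ∀ w → w ≢ v → G4m2 m w (encode valid-P) ⊎ G4m2 m w (encode valid-Q)
    dominates′ w w≢v =
      subst₂ (λ A B → H (decode m w) A ⊎ H (decode m w) B) (sym (decode-encode valid-P)) (sym (decode-encode valid-Q))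
             (dominates (decode-valid w) (w≢v ∘ decode-injective))

theorem2p5 : (m : ℕ) → 3 ≤ m → IsTotalDomCritical 3 (G4m2 m)
-- G has no vertex of degree one, so criticality is proved for every vertex v.
theorem2p5 (suc (suc (suc q))) (s≤s (s≤s (s≤s z≤n))) = γₜ≡3 , λ v _ → γₜ[G-v]≡2 v
  where open Properties q
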